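{- Define $X\colon\mathbb N_{\ge1}\times\mathbb N_{\ge1}\to\mathbb N$ by $X(m,d)=1$ if $d=1$ or $m=1$, and otherwise $X(m,d)=X(m-1,d)\cdot\big((m-1)\cdot X(m,d-1)+1\big)+X(m,d-1)$. Then for all $m,d\ge1$, $X(m,d)\le\prod_{i=1}^{m+d}(m+d)^{2^i}$. -}

module Defs where

open import Data.Nat using (ℕ; zero; suc; _+_; _*_; _^_)

-- Values at m = 0 or d = 0 lie outside the paper's domain and are set to 1
-- (they are never used by the statement or by the recursion from m,d ≥ 1).
X : ℕ → ℕ → ℕ
X (suc (suc m)) (suc (suc d)) =
  X (suc m) (suc (suc d)) * (suc m * X (suc (suc m)) (suc d) + 1)
  + X (suc (suc m)) (suc d)
X _ _ = 1

prodFrom1 : ℕ → (ℕ → ℕ) → ℕ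
prodFrom1 zero    f = 1
prodFrom1 (suc k) f = prodFrom1 k f * f (suc k)

{-# OPTIONS --safe #-}
-- Strengthen the claim to N · X(m,d) ≤ N^(2^(m+d)) for every N ≥ m + d and
-- induct along the recursion. Since X(m-1,d), X(m,d-1) ≥ 1, the recursion gives
-- X(m,d) ≤ X(m-1,d) · X(m,d-1) · (m+1), and the factor m + 1 ≤ N is paid for by
-- the extra N on the left, so the two induction hypotheses multiply to
-- N^(2^(m+d-1)) · N^(2^(m+d-1)) = N^(2^(m+d)). With N = m + d this is the last
-- factor of the product in the theorem.
module Submission where

open import Defs
open import Data.Nat using (ℕ; zero; suc; _+_; _*_; _^_; _≤_; s≤s; z≤n; NonZero; >-nonZero)
open import Data.Nat.Properties
open import Data.Nat.Solver using (module +-*-Solver)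
open import Relation.Binary.PropositionalEquality using (_≡_; refl; sym; cong; subst; module ≡-Reasoning)
open +-*-Solver using (solve; _:+_; _:*_; _:=_; con)

X-positive : ∀ m d → 1 ≤ X m d
X-positive zero          d             = s≤s z≤n
X-positive (suc zero)    d             = s≤s z≤n
X-positive (suc (suc m)) zero          = s≤s z≤n
X-positive (suc (suc m)) (suc zero)    = s≤s z≤n
X-positive (suc (suc m)) (suc (suc d)) =
  ≤-trans (X-positive (suc (suc m)) (suc d)) (m≤n+m _ _)

recurrence-≤-product : ∀ {a b} k → 1 ≤ a → 1 ≤ b → a * (k * b + 1) + b ≤ a * b * (2 + k)
recurrence-≤-product {a} {b} k 1≤a 1≤b = begin
  a * (k * b + 1) + b      ≤⟨ +-mono-≤ (*-monoʳ-≤ a (+-monoʳ-≤ (k * b) 1≤b))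
                                       (m≤n*m b a {{>-nonZero 1≤a}}) ⟩
  a * (k * b + b) + a * b  ≡⟨ solve 3 (λ a b k → a :* (k :* b :+ b) :+ a :* b
                                               := a :* b :* (con 2 :+ k)) refl a b k ⟩
  a * b * (2 + k)          ∎
  where open ≤-Reasoning

X-≤-product : ∀ m d → X (2 + m) (2 + d) ≤ X (1 + m) (2 + d) * X (2 + m) (1 + d) * (3 + m)
X-≤-product m d =
  recurrence-≤-product (suc m) (X-positive (1 + m) (2 + d)) (X-positive (2 + m) (1 + d))

^-2^-suc : ∀ a n → a ^ (2 ^ suc n) ≡ a ^ (2 ^ n) * a ^ (2 ^ n)
^-2^-suc a n = begin
  a ^ (2 ^ n + (2 ^ n + 0))  ≡⟨ cong (λ e → a ^ (2 ^ n + e)) (+-identityʳ (2 ^ n)) ⟩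
  a ^ (2 ^ n + 2 ^ n)        ≡⟨ ^-distribˡ-+-* a (2 ^ n) (2 ^ n) ⟩
  a ^ (2 ^ n) * a ^ (2 ^ n)  ∎
  where open ≡-Reasoning

*X-≤-^2^ : ∀ N .{{_ : NonZero N}} m d → m + d ≤ N → N * X m d ≤ N ^ (2 ^ (m + d))
-- N * 1 unfolds to N ^ 1, so the base cases are 1 ≤ 2 ^ k lifted through N ^_.
*X-≤-^2^ N zero          d             _ = ^-monoʳ-≤ N (m^n>0 2 d)
*X-≤-^2^ N (suc zero)    d             _ = ^-monoʳ-≤ N (m^n>0 2 (suc d))
*X-≤-^2^ N (suc (suc m)) zero          _ = ^-monoʳ-≤ N (m^n>0 2 (suc (suc m) + 0))
*X-≤-^2^ N (suc (suc m)) (suc zero)    _ = ^-monoʳ-≤ N (m^n>0 2 (suc (suc m) + 1))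
*X-≤-^2^ N (suc (suc m)) (suc (suc d)) m+d≤N = begin
  N * X (2 + m) (2 + d)      ≤⟨ *-monoʳ-≤ N (X-≤-product m d) ⟩
  N * (A * B * (3 + m))      ≤⟨ *-monoʳ-≤ N (*-monoʳ-≤ (A * B) 3+m≤N) ⟩
  N * (A * B * N)            ≡⟨ solve 3 (λ N A B → N :* (A :* B :* N) := (N :* A) :* (N :* B))
                                        refl N A B ⟩
  (N * A) * (N * B)          ≤⟨ *-mono-≤ (*X-≤-^2^ N (suc m) (suc (suc d)) n≤N)
                                         (subst (λ e → N * B ≤ N ^ (2 ^ e)) shift
                                                (*X-≤-^2^ N (suc (suc m)) (suc d) n′≤N)) ⟩
  N ^ (2 ^ n) * N ^ (2 ^ n)  ≡⟨ ^-2^-suc N n ⟨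
  N ^ (2 ^ suc n)            ∎
  where
  open ≤-Reasoning
  A = X (1 + m) (2 + d)
  B = X (2 + m) (1 + d)
  n = (1 + m) + (2 + d)
  n≤N : n ≤ N
  n≤N = ≤-trans (n≤1+n n) m+d≤N
  shift : (2 + m) + (1 + d) ≡ n
  shift = sym (+-suc (1 + m) (1 + d))
  n′≤N : (2 + m) + (1 + d) ≤ N
  n′≤N = subst (_≤ N) (sym shift) n≤N
  3+m≤N : 3 + m ≤ N
  3+m≤N = ≤-trans (m≤m+n (3 + m) d) (subst (_≤ N) (+-suc (2 + m) d) n′≤N)

prodFrom1-positive : ∀ k f → (∀ i → 1 ≤ f i) → 1 ≤ prodFrom1 k f
prodFrom1-positive zero    f f-positive = s≤s z≤n
prodFrom1-positive (suc k) f f-positive =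
  *-mono-≤ (prodFrom1-positive k f f-positive) (f-positive (suc k))

last-factor-≤-prodFrom1 : ∀ k f → (∀ i → 1 ≤ f i) → f (suc k) ≤ prodFrom1 (suc k) f
last-factor-≤-prodFrom1 k f f-positive =
  m≤n*m (f (suc k)) (prodFrom1 k f) {{>-nonZero (prodFrom1-positive k f f-positive)}}

mainTheorem13 : (m d : ℕ) → 1 ≤ m → 1 ≤ d →
    X m d ≤ prodFrom1 (m + d) (λ i → (m + d) ^ (2 ^ i))
mainTheorem13 zero    d () _
mainTheorem13 (suc m) d _  _ = begin
  X (suc m) d                  ≤⟨ m≤n*m (X (suc m) d) N ⟩
  N * X (suc m) d              ≤⟨ *X-≤-^2^ N (suc m) d ≤-refl ⟩
  N ^ (2 ^ N)                  ≤⟨ last-factor-≤-prodFrom1 (m + d) (λ i → N ^ (2 ^ i))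
                                                          (λ i → m^n>0 N (2 ^ i)) ⟩
  prodFrom1 N (λ i → N ^ (2 ^ i)) ∎
  where
  open ≤-Reasoning
  N = suc m + d
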